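{- For every $s\in\mathbb W^*$, the set $\downarrow L_s=\{z\in\mathcal Z: z\le (m,s)\text{ for some }m\in\mathbb W\}$ is Scott closed and irreducible in $\mathcal Z$.
   Context: Let $\omega_1$ be the first uncountable ordinal and $\mathbb W=[0,\omega_1)$ the set of countable ordinals with their usual order. Let $\mathbb W^*$ be the set of finite strings of elements of $\mathbb W$, with $\varepsilon$ the empty string; for $u\in\mathbb W$, $s\in\mathbb W^*$, $u.s$ is the string obtained by putting $u$ in front of $s$; for $s,t\in\mathbb W^*$, $ts$ is the concatenation of $t$ followed by $s$; for nonempty $t$, $\min(t)$ is the least ordinal occurring in $t$. On $\mathcal Z=\mathbb W\times\mathbb W^*$ define, for $m,m',u,u'\in\mathbb W$ and $s,t\in\mathbb W^*$: $(m,u.s)<_1(m,u'.s)$ iff $u<u'$; $(m,ts)<_2(m,s)$ iff $t\neq\varepsilon$; $(m,ts)<_3(m',s)$ iff $t\ne\varepsilon$ and $\min(t)\le m'$. With $R;S$ the relational composite, let $<\,=\,<_1\cup<_2\cup<_3\cup(<_2;<_1)\cup(<_3;<_1)$ and $\le\,=\,<\cup=$; this is a partial order and $\mathcal Z$ denotes the resulting poset. $L_s=\{(m,s):m\in\mathbb W\}$. Scott closed sets: lower sets containing the supremum of each of their directed subsets whose supremum exists. A closed set $C$ is irreducible if it is nonempty and $C\subseteq A\cup B$ with $A,B$ closed implies $C\subseteq A$ or $C\subseteq B$. -}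

module Defs where

open import Level using (0ℓ)
open import Data.Nat using (ℕ)
open import Data.Empty using (⊥)
open import Data.List using (List; []; _∷_; _++_)
open import Data.Product using (Σ; ∃; ∃-syntax; _×_; _,_; proj₁; proj₂)
open import Data.Sum using (_⊎_; inj₁; inj₂)
open import Relation.Nullary using (¬_)
open import Relation.Binary.PropositionalEquality using (_≡_)
open import Relation.Binary.Core using (Rel)
open import Relation.Binary.Structures using (IsStrictTotalOrder)
open import Relation.Binary.Definitions using (tri<; tri≈; tri>)
open import Induction.WellFounded using (WellFounded)

-- ω₁ = [0, ω₁), the countable ordinals, characterised (up to order
-- isomorphism, classically) as a well-ordered set in which every proper
-- initial segment is countable but the whole set is uncountable.

record Omega1 : Set₁ where
  field
    W        : Set
    _<W_     : Rel W 0ℓ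
    isSTO    : IsStrictTotalOrder _≡_ _<W_
    wf       : WellFounded _<W_
    segCountable : ∀ u → Σ (Σ W (λ v → v <W u) → ℕ)
                     (λ f → ∀ a b → f a ≡ f b → proj₁ a ≡ proj₁ b)
    uncountable : ¬ Σ (W → ℕ) (λ f → ∀ a b → f a ≡ f b → a ≡ b)

module ZPoset (Ω : Omega1) where
  open Omega1 Ω public

  _≤W_ : W → W → Set
  u ≤W v = u <W v ⊎ u ≡ v

  minW : W → W → W
  minW u v with IsStrictTotalOrder.compare isSTO u v
  ... | tri< _ _ _ = u
  ... | tri≈ _ _ _ = u
  ... | tri> _ _ _ = v

  minL : W → List W → W
  minL u []       = u
  minL u (v ∷ vs) = minW u (minL v vs)

  Z : Set
  Z = W × List W

  _<₁_ : Z → Z → Set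
  (m , [])    <₁ _             = ⊥
  (m , u ∷ s) <₁ (m' , [])     = ⊥
  (m , u ∷ s) <₁ (m' , u' ∷ s') = (m ≡ m') × (s ≡ s') × (u <W u')

  -- (m, t s) <₂ (m, s) iff t ≠ ε   (t written as u.t')
  _<₂_ : Z → Z → Set
  (m , r) <₂ (m' , s) = (m ≡ m') × ∃[ u ] ∃[ t ] (r ≡ (u ∷ t) ++ s)

  _<₃_ : Z → Z → Set
  (m , r) <₃ (m' , s) = ∃[ u ] ∃[ t ] ((r ≡ (u ∷ t) ++ s) × (minL u t ≤W m'))

  _⨾_ : (Z → Z → Set) → (Z → Z → Set) → Z → Z → Set
  (R ⨾ S) x y = ∃[ z ] (R x z × S z y)

  _<_ : Z → Z → Set
  x < y = (x <₁ y) ⊎ (x <₂ y) ⊎ (x <₃ y) ⊎ ((_<₂_ ⨾ _<₁_) x y) ⊎ ((_<₃_ ⨾ _<₁_) x y)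

  _≤_ : Z → Z → Set
  x ≤ y = (x < y) ⊎ (x ≡ y)

  Subset : Set₁
  Subset = Z → Set

  IsLower : Subset → Set
  IsLower C = ∀ x y → x ≤ y → C y → C x

  Directed : Subset → Set
  Directed D = (∃[ d ] D d) × (∀ a b → D a → D b → ∃[ c ] (D c × a ≤ c × b ≤ c))

  IsSup : Subset → Z → Set
  IsSup D x = (∀ d → D d → d ≤ x) × (∀ y → (∀ d → D d → d ≤ y) → x ≤ y)

  ScottClosed : Subset → Set₁
  ScottClosed C = IsLower C ×
    (∀ (D : Subset) x → Directed D → (∀ d → D d → C d) → IsSup D x → C x)

  Irreducible : Subset → Set₁
  Irreducible C = ScottClosed C × (∃[ z ] C z) ×
    (∀ (A B : Subset) → ScottClosed A → ScottClosed B →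
      (∀ z → C z → A z ⊎ B z) → (∀ z → C z → A z) ⊎ (∀ z → C z → B z))

  L : List W → Subset
  L s (m , r) = r ≡ s

  downL : List W → Subset
  downL s z = ∃[ m ] (z ≤ (m , s))

{-# OPTIONS --safe #-}
module Submission where

-- Whether z lies in ↓L_s does not depend on the first coordinate of z, and z ≤ y is either an
-- equality, a <₁-step, or strictly shortens the string. If d₀ = (k , r) has minimal length in a
-- directed D ⊆ ↓L_s, every element of D lies below some e ∈ D with d₀ ≤₁ e; all such e are
-- bounded by (k , s) if r has the length of s, and otherwise, writing r = u.q, by (k , q). Both
-- bounds lie in ↓L_s, hence so does sup D.
-- For irreducibility, (n , s) is the supremum of {(n , w.s) : w ∈ 𝕎}, a set that is directed
-- because the uncountable 𝕎 has no largest element, and (n , w.s) <₃ (k , s) whenever w ≤ k.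
-- So a Scott closed set containing (k , s) for cofinally many k contains ↓L_s, and of two
-- closed sets covering ↓L_s one contains L_s cofinally.

open import Defs
open import Level using (0ℓ)
open import Data.List using (List)
open import Data.Product using (_×_)
open import Axiom.ExcludedMiddle using (ExcludedMiddle)

open import Axiom.DoubleNegationElimination using (em⇒dne)
open import Data.Empty using (⊥; ⊥-elim)
open import Data.List using ([]; _∷_; _++_; length)
open import Data.List.Properties using (length-++; ++-assoc)
open import Data.List.Relation.Unary.All as All using (All; []; _∷_)
open import Data.List.Relation.Unary.Any using (Any; here; there)
open import Data.List.Relation.Unary.Any.Properties using (++⁺ˡ; ++⁺ʳ)
import Data.Nat as ℕ
open ℕ using (ℕ; zero; suc; s≤s)
import Data.Nat.Properties as ℕₚ
open import Data.Nat.Induction using (<-wellFounded)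
open import Data.Product using (Σ; ∃-syntax; _,_; proj₁; proj₂)
open import Data.Sum as Sum using (_⊎_; inj₁; inj₂; [_,_])
open import Function using (_∘_; _on_; id)
open import Induction.WellFounded as WF using (WfRec)
import Relation.Binary.Construct.On as On
import Relation.Binary.Construct.StrictToNonStrict as StrictToNonStrict
open import Relation.Binary.Definitions using (Tri; tri<; tri≈; tri>)
open import Relation.Binary.PropositionalEquality
  using (_≡_; refl; sym; trans; subst; isEquivalence; resp₂)
open import Relation.Binary.Structures using (IsStrictTotalOrder; IsDecTotalOrder)
open import Relation.Nullary using (¬_; yes; no)

module _ (em : ExcludedMiddle 0ℓ) where

  argmin : ∀ {A : Set} {P : A → Set} (f : A → ℕ) {a} → P a →
           ∃[ b ] (P b × ∀ {c} → P c → f b ℕ.≤ f c)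
  argmin {A} {P} f {a} = WF.All.wfRec (On.wellFounded f <-wellFounded) 0ℓ Goal step a
    where
    Goal : A → Set
    Goal a = P a → ∃[ b ] (P b × ∀ {c} → P c → f b ℕ.≤ f c)
    step : ∀ a → WfRec (ℕ._<_ on f) Goal a → Goal a
    step a rec Pa with em {∃[ c ] (P c × f c ℕ.< f a)}
    ... | yes (c , Pc , fc<fa) = rec fc<fa Pc
    ... | no ∄c = a , Pa , λ {c} Pc → ℕₚ.≮⇒≥ λ fc<fa → ∄c (c , Pc , fc<fa)

module _ (Ω : Omega1) where
  open ZPoset Ω
  open IsStrictTotalOrder isSTO using (compare; irrefl; asym; <-respˡ-≈)
    renaming (trans to <W-trans)
  module ≤W = IsDecTotalOrder (StrictToNonStrict.isDecTotalOrder _≡_ _<W_ isSTO)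

  ≤W-<W-trans : ∀ {a b c} → a ≤W b → b <W c → a <W c
  ≤W-<W-trans = StrictToNonStrict.≤-<-trans _≡_ _<W_ sym <W-trans <-respˡ-≈

  ≤W⇒≯ : ∀ {a b} → a ≤W b → ¬ b <W a
  ≤W⇒≯ a≤b b<a = irrefl refl (≤W-<W-trans a≤b b<a)

  minW-sel : ∀ a b → minW a b ≡ a ⊎ minW a b ≡ b
  minW-sel a b with compare a b
  ... | tri< _ _ _ = inj₁ refl
  ... | tri≈ _ _ _ = inj₁ refl
  ... | tri> _ _ _ = inj₂ refl

  minW≤ˡ : ∀ a b → minW a b ≤W a
  minW≤ˡ a b with compare a b
  ... | tri< _ _ _   = inj₂ refl
  ... | tri≈ _ _ _   = inj₂ refl
  ... | tri> _ _ b<a = inj₁ b<a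

  minW≤ʳ : ∀ a b → minW a b ≤W b
  minW≤ʳ a b with compare a b
  ... | tri< a<b _ _ = inj₁ a<b
  ... | tri≈ _ a≡b _ = inj₂ a≡b
  ... | tri> _ _ _   = inj₂ refl

  minL≤⇒Any : ∀ {m} u t → minL u t ≤W m → Any (_≤W m) (u ∷ t)
  minL≤⇒Any u []      u≤m = here u≤m
  minL≤⇒Any {m} u (v ∷ t) min≤m with minW-sel u (minL v t)
  ... | inj₁ eq = here (subst (_≤W m) eq min≤m)
  ... | inj₂ eq = there (minL≤⇒Any v t (subst (_≤W m) eq min≤m))

  Any⇒minL≤ : ∀ {m u t} → Any (_≤W m) (u ∷ t) → minL u t ≤W m
  Any⇒minL≤ {t = []}    (here u≤m) = u≤m
  Any⇒minL≤ {t = v ∷ t} (here u≤m) = ≤W.trans (minW≤ˡ _ (minL v t)) u≤m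
  Any⇒minL≤ {u = u} {v ∷ t} (there any) = ≤W.trans (minW≤ʳ u _) (Any⇒minL≤ any)

  -- Strippable m t m' holds iff (m , t s) ≤ (m' , s) by <₂, <₃ or equality;
  -- for t ≢ [] the Any-clause is the paper's min(t) ≤ m'.
  Strippable : W → List W → W → Set
  Strippable m t m' = m ≡ m' ⊎ Any (_≤W m') t

  strippable-++ : ∀ {m m' m'' t t'} →
    Strippable m t m' → Strippable m' t' m'' → Strippable m (t ++ t') m''
  strippable-++         (inj₁ refl) (inj₁ refl) = inj₁ refl
  strippable-++         (inj₂ any)  (inj₁ refl) = inj₂ (++⁺ˡ any)
  strippable-++ {t = t} _           (inj₂ any)  = inj₂ (++⁺ʳ t any)

  strippable-lowerHead : ∀ {m m' u u' t} →
    u ≤W u' → Strippable m (u' ∷ t) m' → Strippable m (u ∷ t) m'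
  strippable-lowerHead _    (inj₁ m≡m')         = inj₁ m≡m'
  strippable-lowerHead u≤u' (inj₂ (here u'≤m')) = inj₂ (here (≤W.trans u≤u' u'≤m'))
  strippable-lowerHead _    (inj₂ (there any))  = inj₂ (there any)

  strippable-tail : ∀ {m m' w t} →
    Strippable m (w ∷ t) m' → m ≡ m' ⊎ m' <W w → Strippable m t m'
  strippable-tail (inj₁ m≡m')         _            = inj₁ m≡m'
  strippable-tail (inj₂ (there any))  _            = inj₂ any
  strippable-tail (inj₂ (here _))     (inj₁ m≡m')  = inj₁ m≡m'
  strippable-tail (inj₂ (here w≤m'))  (inj₂ m'<w)  = ⊥-elim (≤W⇒≯ w≤m' m'<w)

  -- A normal form of _<_ = <₁ ∪ <₂₃ ∪ (<₂₃ ; <₁), where <₂₃ = <₂ ∪ <₃.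
  infix 4 _<ⁿ_
  data _<ⁿ_ : Z → Z → Set where
    bump       : ∀ {m u u' q} → u <W u' → (m , u ∷ q) <ⁿ (m , u' ∷ q)
    strip      : ∀ {m m' u t p} → Strippable m (u ∷ t) m' → (m , u ∷ t ++ p) <ⁿ (m' , p)
    strip-bump : ∀ {m m' v t u u' q} → Strippable m (v ∷ t) m' → u <W u' →
                 (m , v ∷ t ++ u ∷ q) <ⁿ (m' , u' ∷ q)

  strip-then-<₁ : ∀ {m m' u t r y} →
    Strippable m (u ∷ t) m' → (m' , r) <₁ y → (m , u ∷ t ++ r) <ⁿ y
  strip-then-<₁ {r = _ ∷ _} {y = _ , _ ∷ _} st (refl , refl , a<b) = strip-bump st a<b
  strip-then-<₁ {r = []}                       _ ()
  strip-then-<₁ {r = _ ∷ _} {y = _ , []}       _ ()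

  <⇒<ⁿ : ∀ {x y} → x < y → x <ⁿ y
  <⇒<ⁿ {_ , _ ∷ _} {_ , _ ∷ _} (inj₁ (refl , refl , u<u')) = bump u<u'
  <⇒<ⁿ {_ , []}                 (inj₁ ())
  <⇒<ⁿ {_ , _ ∷ _} {_ , []}     (inj₁ ())
  <⇒<ⁿ (inj₂ (inj₁ (refl , _ , _ , refl))) = strip (inj₁ refl)
  <⇒<ⁿ (inj₂ (inj₂ (inj₁ (u , t , refl , min≤)))) = strip (inj₂ (minL≤⇒Any u t min≤))
  <⇒<ⁿ (inj₂ (inj₂ (inj₂ (inj₁ (_ , (refl , _ , _ , refl) , z<₁y))))) =
    strip-then-<₁ (inj₁ refl) z<₁y
  <⇒<ⁿ (inj₂ (inj₂ (inj₂ (inj₂ (_ , (u , t , refl , min≤) , z<₁y))))) =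
    strip-then-<₁ (inj₂ (minL≤⇒Any u t min≤)) z<₁y

  <ⁿ⇒< : ∀ {x y} → x <ⁿ y → x < y
  <ⁿ⇒< (bump u<u') = inj₁ (refl , refl , u<u')
  <ⁿ⇒< (strip {u = u} {t} (inj₁ refl)) = inj₂ (inj₁ (refl , u , t , refl))
  <ⁿ⇒< (strip {u = u} {t} (inj₂ any)) = inj₂ (inj₂ (inj₁ (u , t , refl , Any⇒minL≤ any)))
  <ⁿ⇒< (strip-bump {v = v} {t} {u} {q = q} (inj₁ refl) u<u') =
    inj₂ (inj₂ (inj₂ (inj₁ ((_ , u ∷ q) , (refl , v , t , refl) , (refl , refl , u<u')))))
  <ⁿ⇒< (strip-bump {v = v} {t} {u} {q = q} (inj₂ any) u<u') =
    inj₂ (inj₂ (inj₂ (inj₂ ((_ , u ∷ q) , (v , t , refl , Any⇒minL≤ any) , (refl , refl , u<u')))))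

  strip-++ : ∀ {m m' m'' u v t t' p} →
    Strippable m (u ∷ t) m' → Strippable m' (v ∷ t') m'' → (m , u ∷ t ++ v ∷ t' ++ p) <ⁿ (m'' , p)
  strip-++ {m} {u = u} {v} {t} {t'} {p} st st' =
    subst (λ r → (m , u ∷ r) <ⁿ _) (++-assoc t (v ∷ t') p) (strip (strippable-++ st st'))

  <ⁿ-bumpʳ : ∀ {x m u u' q} → x <ⁿ (m , u ∷ q) → u <W u' → x <ⁿ (m , u' ∷ q)
  <ⁿ-bumpʳ (bump a<u)          u<u' = bump (<W-trans a<u u<u')
  <ⁿ-bumpʳ (strip st)          u<u' = strip-bump st u<u'
  <ⁿ-bumpʳ (strip-bump st a<u) u<u' = strip-bump st (<W-trans a<u u<u')

  <ⁿ-stripʳ : ∀ {x m m' v t p} → x <ⁿ (m , v ∷ t ++ p) → Strippable m (v ∷ t) m' → x <ⁿ (m' , p)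
  <ⁿ-stripʳ (bump u<v)           st = strip (strippable-lowerHead (inj₁ u<v) st)
  <ⁿ-stripʳ (strip st₀)          st = strip-++ st₀ st
  <ⁿ-stripʳ (strip-bump st₀ u<v) st = strip-++ st₀ (strippable-lowerHead (inj₁ u<v) st)

  <ⁿ-trans : ∀ {x y z} → x <ⁿ y → y <ⁿ z → x <ⁿ z
  <ⁿ-trans x<y (bump u<u')          = <ⁿ-bumpʳ x<y u<u'
  <ⁿ-trans x<y (strip st)           = <ⁿ-stripʳ x<y st
  <ⁿ-trans x<y (strip-bump st u<u') = <ⁿ-bumpʳ (<ⁿ-stripʳ x<y st) u<u'

  <-trans : ∀ {x y z} → x < y → y < z → x < z
  <-trans x<y y<z = <ⁿ⇒< (<ⁿ-trans (<⇒<ⁿ x<y) (<⇒<ⁿ y<z))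

  ≤-trans : ∀ {x y z} → x ≤ y → y ≤ z → x ≤ z
  ≤-trans = StrictToNonStrict.trans _≡_ _<_ isEquivalence (resp₂ _<_) <-trans

  len : Z → ℕ
  len = length ∘ proj₂

  infix 4 _≤₁_
  _≤₁_ : Z → Z → Set
  x ≤₁ y = x <₁ y ⊎ x ≡ y

  ≤₁-proj₁ : ∀ {x y} → x ≤₁ y → proj₁ x ≡ proj₁ y
  ≤₁-proj₁ {_ , _ ∷ _} {_ , _ ∷ _} (inj₁ (m≡m' , _)) = m≡m'
  ≤₁-proj₁ {_ , []}                 (inj₁ ())
  ≤₁-proj₁ {_ , _ ∷ _} {_ , []}     (inj₁ ())
  ≤₁-proj₁                          (inj₂ refl) = refl

  <₁-cons : ∀ {m u u' q} → u <W u' → (m , u ∷ q) < (m , u' ∷ q)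
  <₁-cons u<u' = inj₁ (refl , refl , u<u')

  <₂-cons : ∀ {m u q} → (m , u ∷ q) < (m , q)
  <₂-cons {u = u} = inj₂ (inj₁ (refl , u , [] , refl))

  <₃-cons : ∀ {m m' u q} → u ≤W m' → (m , u ∷ q) < (m' , q)
  <₃-cons {u = u} u≤m' = inj₂ (inj₂ (inj₁ (u , [] , refl , u≤m')))

  ≤₁-tail : ∀ {m w q e} → (m , w ∷ q) ≤₁ e → e < (m , q)
  ≤₁-tail {e = _ , _ ∷ _} (inj₁ (refl , refl , _)) = <₂-cons
  ≤₁-tail {e = _ , []}    (inj₁ ())
  ≤₁-tail                 (inj₂ refl) = <₂-cons

  suffix-shorter : ∀ (u : W) t p → length p ℕ.< length (u ∷ t ++ p)
  suffix-shorter u t p =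
    s≤s (subst (length p ℕ.≤_) (sym (length-++ t)) (ℕₚ.m≤n+m (length p) (length t)))

  <ⁿ⇒<₁⊎shorter : ∀ {x y} → x <ⁿ y → x <₁ y ⊎ len y ℕ.< len x
  <ⁿ⇒<₁⊎shorter (bump u<u')                              = inj₁ (refl , refl , u<u')
  <ⁿ⇒<₁⊎shorter (strip {u = u} {t} {p} _)                = inj₂ (suffix-shorter u t p)
  <ⁿ⇒<₁⊎shorter (strip-bump {v = v} {t} {u} {q = q} _ _) = inj₂ (suffix-shorter v t (u ∷ q))

  ≤⇒≤₁⊎shorter : ∀ {x y} → x ≤ y → x ≤₁ y ⊎ len y ℕ.< len x
  ≤⇒≤₁⊎shorter (inj₁ x<y) = Sum.map₁ inj₁ (<ⁿ⇒<₁⊎shorter (<⇒<ⁿ x<y))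
  ≤⇒≤₁⊎shorter (inj₂ x≡y) = inj₁ (inj₂ x≡y)

  ≤-dropHead : ∀ {m m' w q p} → (m , w ∷ q) ≤ (m' , p) → length p ℕ.< length (w ∷ q) →
    m ≡ m' ⊎ m' <W w → (m , q) ≤ (m' , p)
  ≤-dropHead (inj₂ refl) shorter _ = ⊥-elim (ℕₚ.<-irrefl refl shorter)
  ≤-dropHead (inj₁ lt) shorter h with <⇒<ⁿ lt
  ... | bump _ = ⊥-elim (ℕₚ.<-irrefl refl shorter)
  ... | strip {t = []} st with strippable-tail st h
  ...   | inj₁ refl = inj₂ refl
  ≤-dropHead _ _ h | strip {t = _ ∷ _} st = inj₁ (<ⁿ⇒< (strip (strippable-tail st h)))
  ≤-dropHead _ _ h | strip-bump {t = []} st u<u' with strippable-tail st h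
  ...   | inj₁ refl = inj₁ (<₁-cons u<u')
  ≤-dropHead _ _ h | strip-bump {t = _ ∷ _} st u<u' =
    inj₁ (<ⁿ⇒< (strip-bump (strippable-tail st h) u<u'))

  <ⁿ-keepFirst : ∀ {x m' p} → x <ⁿ (m' , p) → x <ⁿ (proj₁ x , p)
  <ⁿ-keepFirst (bump u<u')         = bump u<u'
  <ⁿ-keepFirst (strip _)           = strip (inj₁ refl)
  <ⁿ-keepFirst (strip-bump _ u<u') = strip-bump (inj₁ refl) u<u'

  downL⇒≤proj₁ : ∀ s {z} → downL s z → z ≤ (proj₁ z , s)
  downL⇒≤proj₁ s (_ , inj₁ z<) = inj₁ (<ⁿ⇒< (<ⁿ-keepFirst (<⇒<ⁿ z<)))
  downL⇒≤proj₁ s (_ , inj₂ refl) = inj₂ refl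

  downL-isLower : ∀ s → IsLower (downL s)
  downL-isLower s x y x≤y (m , y≤) = m , ≤-trans x≤y y≤

  reach-minimal-level : ∀ {D : Subset} {d₀} →
    (∀ a b → D a → D b → ∃[ c ] (D c × a ≤ c × b ≤ c)) → D d₀ → (∀ {d} → D d → len d₀ ℕ.≤ len d) →
    ∀ d → D d → ∃[ e ] (D e × d ≤ e × d₀ ≤₁ e)
  reach-minimal-level {d₀ = d₀} up d₀∈D minimal d d∈D with up d d₀ d∈D d₀∈D
  ... | e , e∈D , d≤e , d₀≤e with ≤⇒≤₁⊎shorter d₀≤e
  ...   | inj₁ d₀≤₁e    = e , e∈D , d≤e , d₀≤₁e
  ...   | inj₂ shorter = ⊥-elim (ℕₚ.<⇒≱ shorter (minimal e∈D))

  downL-bound : ∀ s {k r} → downL s (k , r) →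
    ∃[ c ] (downL s c × ∀ e → downL s e → (k , r) ≤₁ e → e ≤ c)
  downL-bound s {k} {r} d₀∈ with ≤⇒≤₁⊎shorter (downL⇒≤proj₁ s d₀∈)
  ... | inj₁ _ = (k , s) , (k , inj₂ refl) , λ e e∈ d₀≤₁e →
    subst (λ m → e ≤ (m , s)) (sym (≤₁-proj₁ d₀≤₁e)) (downL⇒≤proj₁ s e∈)
  ... | inj₂ shorter with r
  ...   | [] = ⊥-elim (ℕₚ.n≮0 shorter)
  ...   | w ∷ q = (k , q) , (k , ≤-dropHead (downL⇒≤proj₁ s d₀∈) shorter (inj₁ refl)) ,
                  λ _ _ d₀≤₁e → inj₁ (≤₁-tail d₀≤₁e)

  module _ (em : ExcludedMiddle 0ℓ) where

    W-inhabited : W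
    W-inhabited with em {W}
    ... | yes w = w
    ... | no ∄w = ⊥-elim (uncountable ((λ w → ⊥-elim (∄w w)) , λ w → ⊥-elim (∄w w)))

    bounded⇒countable : ∀ a → (∀ w → ¬ a <W w) →
      Σ (W → ℕ) (λ f → ∀ x y → f x ≡ f y → x ≡ y)
    bounded⇒countable a a-max = (λ w → code (compare w a)) , λ x y → code-injective (compare x a) (compare y a)
      where
      code : ∀ {w} → Tri (w <W a) (w ≡ a) (a <W w) → ℕ
      code {w} (tri< w<a _ _) = suc (proj₁ (segCountable a) (w , w<a))
      code     (tri≈ _ _ _)   = zero
      code {w} (tri> _ _ a<w) = ⊥-elim (a-max w a<w)
      code-injective : ∀ {x y} (cx : Tri (x <W a) (x ≡ a) (a <W x)) (cy : Tri (y <W a) (y ≡ a) (a <W y)) →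
        code cx ≡ code cy → x ≡ y
      code-injective {x} {y} (tri< x<a _ _) (tri< y<a _ _) eq =
        proj₂ (segCountable a) (x , x<a) (y , y<a) (ℕₚ.suc-injective eq)
      code-injective (tri≈ _ x≡a _) (tri≈ _ y≡a _) _ = trans x≡a (sym y≡a)
      code-injective (tri< _ _ _) (tri≈ _ _ _) ()
      code-injective (tri≈ _ _ _) (tri< _ _ _) ()
      code-injective {x} (tri> _ _ a<x) _ _ = ⊥-elim (a-max x a<x)
      code-injective {y = y} (tri< _ _ _) (tri> _ _ a<y) _ = ⊥-elim (a-max y a<y)
      code-injective {y = y} (tri≈ _ _ _) (tri> _ _ a<y) _ = ⊥-elim (a-max y a<y)

    <W-unbounded : ∀ a → ∃[ b ] (a <W b)
    <W-unbounded a with em {∃[ b ] (a <W b)}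
    ... | yes a<b = a<b
    ... | no ∄b = ⊥-elim (uncountable (bounded⇒countable a λ w a<w → ∄b (w , a<w)))

    above-both : ∀ a b → ∃[ c ] (a <W c × b <W c)
    above-both a b with ≤W.total a b
    ... | inj₁ a≤b = let c , b<c = <W-unbounded b in c , ≤W-<W-trans a≤b b<c , b<c
    ... | inj₂ b≤a = let c , a<c = <W-unbounded a in c , a<c , ≤W-<W-trans b≤a a<c

    upper-bound : ∀ ws → ∃[ w ] All (_<W w) ws
    upper-bound []       = W-inhabited , []
    upper-bound (a ∷ ws) =
      let b , ws<b = upper-bound ws
          c , a<c , b<c = above-both a b
      in c , a<c ∷ All.map (λ x<b → <W-trans x<b b<c) ws<b

    downL-supClosed : ∀ s (D : Subset) x → Directed D → (∀ d → D d → downL s d) → IsSup D x →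
      downL s x
    downL-supClosed s D x ((_ , d∈D) , up) D⊆ (_ , least) with argmin em len d∈D
    ... | d₀ , d₀∈D , minimal with downL-bound s (D⊆ d₀ d₀∈D)
    ...   | c , c∈ , bound = downL-isLower s x c (least c below-c) c∈
      where
      below-c : ∀ d → D d → d ≤ c
      below-c d d∈D with reach-minimal-level up d₀∈D minimal d d∈D
      ... | e , e∈D , d≤e , d₀≤₁e = ≤-trans d≤e (bound e (D⊆ e e∈D) d₀≤₁e)

    downL-scottClosed : ∀ s → ScottClosed (downL s)
    downL-scottClosed s = downL-isLower s , downL-supClosed s

    Extensions : W → List W → Subset
    Extensions n s z = ∃[ w ] (z ≡ (n , w ∷ s))

    extensions-directed : ∀ n s → Directed (Extensions n s)
    extensions-directed n s = ((n , W-inhabited ∷ s) , W-inhabited , refl) , bound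
      where
      bound : ∀ a b → Extensions n s a → Extensions n s b →
        ∃[ c ] (Extensions n s c × a ≤ c × b ≤ c)
      bound _ _ (u , refl) (v , refl) =
        let w , u<w , v<w = above-both u v
        in (n , w ∷ s) , (w , refl) , inj₁ (<₁-cons u<w) , inj₁ (<₁-cons v<w)

    extensions-sup : ∀ n s → IsSup (Extensions n s) (n , s)
    extensions-sup n s = (λ { _ (_ , refl) → inj₁ <₂-cons }) , least
      where
      least : ∀ y → (∀ d → Extensions n s d → d ≤ y) → (n , s) ≤ y
      least (n' , p) ub with upper-bound (n' ∷ p)
      ... | w , n'<w ∷ p<w with ub (n , w ∷ s) (w , refl)
      ...   | ext≤y with ≤⇒≤₁⊎shorter ext≤y
      ...     | inj₂ shorter = ≤-dropHead ext≤y shorter (inj₂ n'<w)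
      ...     | inj₁ (inj₂ refl) = ⊥-elim (irrefl refl (All.head p<w))
      ...     | inj₁ (inj₁ w<₁p) = ⊥-elim (below-head w<₁p p<w)
        where
        below-head : ∀ {q} → (n , w ∷ s) <₁ (n' , q) → All (_<W w) q → ⊥
        below-head {_ ∷ _} (_ , _ , w<u) (u<w ∷ _) = asym w<u u<w
        below-head {[]} ()

    Cofinal : (W → Set) → Set
    Cofinal P = ∀ w → ∃[ k ] (w ≤W k × P k)

    cofinal-split : ∀ {P Q : W → Set} → (∀ k → P k ⊎ Q k) → Cofinal P ⊎ Cofinal Q
    cofinal-split {P} P∪Q with em {∃[ v ] ¬ (∃[ k ] (v ≤W k × P k))}
    ... | no ∄v = inj₁ λ w → em⇒dne em λ ¬P-above-w → ∄v (w , ¬P-above-w)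
    ... | yes (v , ¬P-above-v) = inj₂ λ w →
      let k , w<k , v<k = above-both w v
      in k , inj₁ w<k , [ (λ Pk → ⊥-elim (¬P-above-v (k , inj₁ v<k , Pk))) , id ] (P∪Q k)

    scottClosed⊇downL : ∀ {s C} → ScottClosed C → Cofinal (λ k → C (k , s)) → ∀ z → downL s z → C z
    scottClosed⊇downL {s} {C} (C-lower , C-sup) cofinal z (m , z≤) = C-lower z (m , s) z≤ (L⊆C m)
      where
      L⊆C : ∀ n → C (n , s)
      L⊆C n = C-sup (Extensions n s) (n , s) (extensions-directed n s) extensions⊆C (extensions-sup n s)
        where
        extensions⊆C : ∀ d → Extensions n s d → C d
        extensions⊆C _ (w , refl) =
          let k , w≤k , C[k,s] = cofinal w
          in C-lower (n , w ∷ s) (k , s) (inj₁ (<₃-cons w≤k)) C[k,s]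

    downL-irreducible : ∀ s → Irreducible (downL s)
    downL-irreducible s = downL-scottClosed s , ((W-inhabited , s) , W-inhabited , inj₂ refl) , split
      where
      split : ∀ (A B : Subset) → ScottClosed A → ScottClosed B → (∀ z → downL s z → A z ⊎ B z) →
        (∀ z → downL s z → A z) ⊎ (∀ z → downL s z → B z)
      split A B A-closed B-closed cover =
        Sum.map (scottClosed⊇downL A-closed) (scottClosed⊇downL B-closed)
                (cofinal-split λ k → cover (k , s) (k , inj₂ refl))

mainTheorem9 : ExcludedMiddle 0ℓ → (Ω : Omega1) → (s : List (Omega1.W Ω)) →
    ZPoset.ScottClosed Ω (ZPoset.downL Ω s) × ZPoset.Irreducible Ω (ZPoset.downL Ω s)
mainTheorem9 em Ω s = downL-scottClosed Ω em s , downL-irreducible Ω em s
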